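{- Let $\mathcal{M}=(M_i\colon i\in K)$ be a family of matroids on a common ground set $E$. Let $(I_i\colon i\in K)$ be a family of pairwise disjoint subsets of $E$ such that $I_i$ is independent in $M_i$ for all $i\in K$, and let $e\in E\setminus\bigcup_{i\in K}I_i$. Then exactly one of the following two statements holds. (1) There are a family of sets $(J_i\colon i\in K)$ and $k\in K$ such that: (a) $J_i$ is independent in $M_i$ for all $i$; (b) $J_i\cap J_j=\emptyset$ for $i\neq j$; (c) $\bigcup_{i\in K}J_i=\bigcup_{i\in K}I_i\cup\{e\}$; (d) $\sum_{i\in K}|I_i\triangle J_i|<\aleph_0$; (e) $\mathrm{span}_{M_i}(J_i)=\mathrm{span}_{M_i}(I_i)$ for all $i\neq k$, and $\mathrm{span}_{M_k}(J_k\setminus\{f\})=\mathrm{span}_{M_k}(I_k)$ for some $f\in J_k$. (2) There exists $X\subseteq\bigcup_{i\in K}I_i$ such that for every $i\in K$ the set $I_i\cap X$ spans $X\cup\{e\}$ in $M_i$.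
   Context: Matroids are possibly infinite: a matroid on $E$ is $(E,\mathcal{I})$ with $\mathcal{I}\subseteq\mathcal{P}(E)$ such that $\emptyset\in\mathcal{I}$; $\mathcal{I}$ is closed under subsets; whenever $I,B\in\mathcal{I}$ with $B$ maximal and $I$ not maximal there is $x\in B\setminus I$ with $I\cup\{x\}\in\mathcal{I}$; and for every $X\subseteq E$ every independent $I\subseteq X$ extends to a maximal element of $\mathcal{I}\cap\mathcal{P}(X)$. Minimal dependent sets are circuits. A set $X$ spans $e$ in $M$ if $e\in X$ or there is a circuit $C\ni e$ with $C\setminus\{e\}\subseteq X$; $\mathrm{span}_M(X)$ is the set of elements spanned by $X$ in $M$; "$A$ spans $Y$" means $Y\subseteq\mathrm{span}_M(A)$. $K$ is an arbitrary index set. -}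

module Defs where

open import Level using (0ℓ)
open import Data.Empty using (⊥)
open import Data.Product using (Σ; ∃; _×_; _,_)
open import Data.Sum using (_⊎_)
open import Data.List using (List)
open import Data.List.Membership.Propositional using (_∈_)
open import Relation.Nullary using (¬_)
open import Relation.Binary.PropositionalEquality using (_≡_; _≢_)

Subset : Set → Set₁
Subset E = E → Set

∅ : {E : Set} → Subset E
∅ _ = ⊥

_⊆_ : {E : Set} → Subset E → Subset E → Set
A ⊆ B = ∀ x → A x → B x

_≐_ : {E : Set} → Subset E → Subset E → Set
A ≐ B = (A ⊆ B) × (B ⊆ A)

_∪_ : {E : Set} → Subset E → Subset E → Subset E
(A ∪ B) x = A x ⊎ B x

_∩_ : {E : Set} → Subset E → Subset E → Subset E
(A ∩ B) x = A x × B x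

｛_｝ : {E : Set} → E → Subset E
｛ e ｝ x = x ≡ e

_∖_ : {E : Set} → Subset E → Subset E → Subset E
(A ∖ B) x = A x × ¬ B x

_△_ : {E : Set} → Subset E → Subset E → Subset E
A △ B = (A ∖ B) ∪ (B ∖ A)

⋃ : {E K : Set} → (K → Subset E) → Subset E
⋃ {K = K} A x = Σ K λ i → A i x

-- Infinite matroids via the independence axioms (I1),(I2),(I3),(IM).
module _ {E : Set} (Indep : Subset E → Set) where

  MaximalIn : Subset E → Subset E → Set₁
  MaximalIn X B = Indep B × B ⊆ X × (∀ J → Indep J → B ⊆ J → J ⊆ X → J ⊆ B)

  MaximalIndep : Subset E → Set₁
  MaximalIndep B = Indep B × (∀ J → Indep J → B ⊆ J → J ⊆ B)

record Matroid (E : Set) : Set₁ where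
  field
    Indep : Subset E → Set
    indep-∅ : Indep ∅
    indep-⊆ : ∀ {I J} → J ⊆ I → Indep I → Indep J
    augment : ∀ {I B} → Indep I → ¬ MaximalIndep Indep I → MaximalIndep Indep B →
              Σ E λ x → B x × ¬ I x × Indep (I ∪ ｛ x ｝)
    extend : ∀ (X I : Subset E) → Indep I → I ⊆ X →
             Σ (Subset E) λ B → I ⊆ B × MaximalIn Indep X B

open Matroid public

Circuit : {E : Set} → Matroid E → Subset E → Set₁
Circuit M C = ¬ Indep M C × (∀ D → D ⊆ C → ¬ Indep M D → C ⊆ D)

Spans : {E : Set} → Matroid E → Subset E → E → Set₁
Spans {E} M X e = X e ⊎ Σ (Subset E) λ C → Circuit M C × C e × (C ∖ ｛ e ｝) ⊆ X

span : {E : Set} → Matroid E → Subset E → E → Set₁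
span M X e = Spans M X e

SpansSet : {E : Set} → Matroid E → Subset E → Subset E → Set₁
SpansSet M A Y = ∀ y → Y y → Spans M A y

SameSpan : {E : Set} → Matroid E → Subset E → Subset E → Set₁
SameSpan M A B = (∀ x → span M A x → span M B x) × (∀ x → span M B x → span M A x)

-- Σ_i |I_i △ J_i| < ℵ₀ : all pairs (i , x) with x ∈ I_i △ J_i lie in one finite list
FiniteTotalSymDiff : {E K : Set} → (K → Subset E) → (K → Subset E) → Set
FiniteTotalSymDiff {E} {K} I J =
  Σ (List (Σ K λ _ → E)) λ L → ∀ i x → (I i △ J i) x → (i , x) ∈ L

module _ {E K : Set} (M : K → Matroid E) (I : K → Subset E) (e : E) where

  Outcome1 : Set₁
  Outcome1 =
    Σ (K → Subset E) λ J → Σ K λ k →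
      (∀ i → Indep (M i) (J i)) ×
      (∀ i j → i ≢ j → ∀ x → J i x → J j x → ⊥) ×
      (⋃ J ≐ (⋃ I ∪ ｛ e ｝)) ×
      FiniteTotalSymDiff I J ×
      (∀ i → i ≢ k → SameSpan (M i) (J i) (I i)) ×
      (Σ E λ f → J k f × SameSpan (M k) (J k ∖ ｛ f ｝) (I k))

  Outcome2 : Set₁
  Outcome2 =
    Σ (Subset E) λ X → X ⊆ ⋃ I ×
      (∀ i → SpansSet (M i) (I i ∩ X) (X ∪ ｛ e ｝))

module Submission where

-- Call w reachable from e in n steps if there is a path
-- e = x₀, x₁, …, xₙ = w where each step is a circuit C_j of some M_{i_j} with
-- C_j − x_j ⊆ I_{i_j} and x_{j+1} ∈ C_j − x_j.  If every reachable element is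
-- spanned by every I_k, the reachable elements of ⋃ I form the set X of (2).
-- Otherwise take a shortest path to an element xₙ not spanned by I_k and, in each
-- M_i, exchange x_{j+1} for x_j along the steps taken in M_i.  Minimality makes
-- these exchanges non-interfering, so each result is independent with the span of
-- I_i (multi-exchange); adding xₙ to the k-th set gives (1).  Given both, in each M_i the independent set J_i ∩ (X + e) is
-- spanned by I_i ∩ X and differs from it finitely, so the finite exchange lemma
-- injects its new elements into the removed ones; gluing these over i injects a
-- finite set plus e into itself, contradicting the pigeonhole principle.
--
-- The argument is
-- classical; excluded middle is the theorem's first hypothesis.

open import Defs
open import Level using (Level; Setω)
open import Axiom.ExcludedMiddle using (ExcludedMiddle)
open import Data.Empty using (⊥; ⊥-elim)
open import Data.Unit using (⊤; tt)
open import Data.Product using (Σ; _×_; _,_; proj₁; proj₂)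
open import Data.Sum using (_⊎_; inj₁; inj₂; [_,_])
open import Data.Nat using (ℕ; zero; suc; pred; _<_; _≤_; z≤n; s≤s; _+_; _∸_)
open import Data.Nat.Properties
  using (m<n⇒m<1+n; n<1+n; m<1+n⇒m<n∨m≡n; m≤n⇒m<n∨m≡n; <⇒≤; <⇒≢; <-trans; <-≤-trans; ≤-trans; ≤-refl;
         <-cmp; +-suc; +-identityʳ; m<m+n; m+[n∸m]≡n)
open import Data.List using (List; []; _∷_; map)
open import Data.List.Membership.Propositional using (_∈_)
open import Data.List.Membership.Propositional.Properties using (∈-map⁺)
open import Data.List.Relation.Unary.Any using (here; there)
open import Data.List.Relation.Unary.Any.Properties using (¬Any[])
open import Relation.Nullary using (¬_; Dec; yes; no)
open import Relation.Nullary.Decidable using (True; toWitness; fromWitness; decidable-stable)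
open import Relation.Binary.Definitions using (tri<; tri≈; tri>)
open import Relation.Binary.PropositionalEquality using (_≡_; _≢_; refl; sym; trans; subst; cong; cong₂; ≢-sym)

LEM : Setω
LEM = ∀ {ℓ : Level} → ExcludedMiddle ℓ

module _ {E : Set} where

  ⊆-trans : {A B C : Subset E} → A ⊆ B → B ⊆ C → A ⊆ C
  ⊆-trans A⊆B B⊆C x Ax = B⊆C x (A⊆B x Ax)

  ∪-⊆ : {A B C : Subset E} → A ⊆ C → B ⊆ C → (A ∪ B) ⊆ C
  ∪-⊆ A⊆C B⊆C x (inj₁ Ax) = A⊆C x Ax
  ∪-⊆ A⊆C B⊆C x (inj₂ Bx) = B⊆C x Bx

  ｛｝-⊆ : {A : Subset E} {x : E} → A x → ｛ x ｝ ⊆ A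
  ｛｝-⊆ Ax _ refl = Ax

  swap : Subset E → E → E → Subset E
  swap A y x = (A ∖ ｛ y ｝) ∪ ｛ x ｝

  drop-point : {A C : Subset E} {y : E} → ¬ C y → C ⊆ (A ∪ ｛ y ｝) → C ⊆ A
  drop-point y∉C C⊆A+y c Cc with C⊆A+y c Cc
  ... | inj₁ Ac = Ac
  ... | inj₂ refl = ⊥-elim (y∉C Cc)

  cover-tail : {P : Subset E} {h : E} {t : List E} →
               P ⊆ (_∈ h ∷ t) → (∀ u → P u → u ≢ h) → P ⊆ (_∈ t)
  cover-tail P⊆h∷t avoid u Pu with P⊆h∷t u Pu
  ... | here u≡h = ⊥-elim (avoid u Pu u≡h)
  ... | there u∈t = u∈t

module Classical (lem : LEM) where

  dne : ∀ {ℓ} {P : Set ℓ} → ¬ ¬ P → P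
  dne = decidable-stable lem

  least : ∀ {ℓ} (P : ℕ → Set ℓ) n → P n → Σ ℕ λ m → P m × (∀ k → k < m → ¬ P k)
  least P zero P0 = 0 , P0 , λ _ ()
  least P (suc n) Psn with lem {P = P 0}
  ... | yes P0 = 0 , P0 , λ _ ()
  ... | no ¬P0 with least (λ k → P (suc k)) n Psn
  ...   | m , Pm , below = suc m , Pm , λ { zero _ → ¬P0 ; (suc k) (s≤s k<m) → below k k<m }

  module _ {E : Set} where

    add-back : {A C : Subset E} {x : E} → (C ∖ ｛ x ｝) ⊆ A → C ⊆ (A ∪ ｛ x ｝)
    add-back {x = x} C-x⊆A c Cc with lem {P = c ≡ x}
    ... | yes c≡x = inj₂ c≡x
    ... | no c≢x = inj₁ (C-x⊆A c (Cc , c≢x))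

    -- If C − x ⊆ A then C − y ⊆ A − y + x: after exchanging y for x along C, the
    -- circuit supports the reverse exchange.
    swap-support : {A C : Subset E} {x y : E} → (C ∖ ｛ x ｝) ⊆ A → (C ∖ ｛ y ｝) ⊆ swap A y x
    swap-support C-x⊆A c (Cc , c≢y) = [ (λ Ac → inj₁ (Ac , c≢y)) , inj₂ ] (add-back C-x⊆A c Cc)

record _↪_ {E : Set} (P Q : Subset E) : Set where
  field
    to : ∀ u → P u → E
    to-∈ : ∀ u (p : P u) → Q (to u p)
    injective : ∀ u v (p : P u) (q : P v) → to u p ≡ to v q → u ≡ v
open _↪_

module _ {E : Set} where

  ↪-mono : {P P' Q Q' : Subset E} → P' ⊆ P → Q ⊆ Q' → P ↪ Q → P' ↪ Q'
  ↪-mono P'⊆P Q⊆Q' φ = record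
    { to = λ u p → to φ u (P'⊆P u p)
    ; to-∈ = λ u p → Q⊆Q' _ (to-∈ φ u (P'⊆P u p))
    ; injective = λ u v p q → injective φ u v (P'⊆P u p) (P'⊆P v q) }

  ↪-empty : {P Q : Subset E} → (∀ u → ¬ P u) → P ↪ Q
  ↪-empty empty = record
    { to = λ u p → ⊥-elim (empty u p)
    ; to-∈ = λ u p → ⊥-elim (empty u p)
    ; injective = λ u v p q _ → ⊥-elim (empty u p) }

module Injections (lem : LEM) {E : Set} where
  open Classical lem

  ↪-insert : {P Q : Subset E} {b h : E} → P ↪ Q → ¬ Q h → (P ∪ ｛ b ｝) ↪ (Q ∪ ｛ h ｝)
  ↪-insert {P} {Q} {b} {h} φ h∉Q = record
    { to = λ u p → send u p lem
    ; to-∈ = λ u p → send-∈ u p lem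
    ; injective = λ u v p q → send-injective u v p q lem lem }
    where
    send : ∀ u → (P ∪ ｛ b ｝) u → Dec (u ≡ b) → E
    send u _ (yes _) = h
    send u (inj₁ Pu) (no _) = to φ u Pu
    send u (inj₂ u≡b) (no u≢b) = ⊥-elim (u≢b u≡b)

    send-∈ : ∀ u p d → (Q ∪ ｛ h ｝) (send u p d)
    send-∈ u _ (yes _) = inj₂ refl
    send-∈ u (inj₁ Pu) (no _) = inj₁ (to-∈ φ u Pu)
    send-∈ u (inj₂ u≡b) (no u≢b) = ⊥-elim (u≢b u≡b)

    send-injective : ∀ u v p q du dv → send u p du ≡ send v q dv → u ≡ v
    send-injective u v _ _ (yes u≡b) (yes v≡b) _ = trans u≡b (sym v≡b)
    send-injective u v _ (inj₁ Pv) (yes _) (no _) h≡φv = ⊥-elim (h∉Q (subst Q (sym h≡φv) (to-∈ φ v Pv)))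
    send-injective u v (inj₁ Pu) _ (no _) (yes _) φu≡h = ⊥-elim (h∉Q (subst Q φu≡h (to-∈ φ u Pu)))
    send-injective u v (inj₁ Pu) (inj₁ Pv) (no _) (no _) eq = injective φ u v Pu Pv eq
    send-injective u v _ (inj₂ v≡b) _ (no v≢b) _ = ⊥-elim (v≢b v≡b)
    send-injective u v (inj₂ u≡b) _ (no u≢b) _ _ = ⊥-elim (u≢b u≡b)

  -- Delete a point c of the domain, and c from the codomain, redirecting the
  -- preimage of c (if any) to φ c.
  ↪-delete : {D Q : Subset E} {c : E} → (φ : D ↪ Q) → (Dc : D c) → (D ∖ ｛ c ｝) ↪ (Q ∖ ｛ c ｝)
  ↪-delete {D} {Q} {c} φ Dc = record
    { to = λ u p → redirect u p lem
    ; to-∈ = λ u p → redirect-∈ u p lem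
    ; injective = λ u v p q → redirect-injective u v p q lem lem }
    where
    redirect : ∀ u → (p : (D ∖ ｛ c ｝) u) → Dec (to φ u (proj₁ p) ≡ c) → E
    redirect u p (yes _) = to φ c Dc
    redirect u p (no _) = to φ u (proj₁ p)

    redirect-∈ : ∀ u p d → (Q ∖ ｛ c ｝) (redirect u p d)
    redirect-∈ u (Du , u≢c) (yes φu≡c) =
      to-∈ φ c Dc , λ φc≡c → u≢c (injective φ u c Du Dc (trans φu≡c (sym φc≡c)))
    redirect-∈ u (Du , _) (no φu≢c) = to-∈ φ u Du , φu≢c

    redirect-injective : ∀ u v p q du dv → redirect u p du ≡ redirect v q dv → u ≡ v
    redirect-injective u v (Du , _) (Dv , _) (yes φu≡c) (yes φv≡c) _ =
      injective φ u v Du Dv (trans φu≡c (sym φv≡c))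
    redirect-injective u v (Du , _) (Dv , v≢c) (yes _) (no _) φc≡φv =
      ⊥-elim (v≢c (sym (injective φ c v Dc Dv φc≡φv)))
    redirect-injective u v (Du , u≢c) (Dv , _) (no _) (yes _) φu≡φc =
      ⊥-elim (u≢c (injective φ u c Du Dc φu≡φc))
    redirect-injective u v (Du , _) (Dv , _) (no _) (no _) eq = injective φ u v Du Dv eq

  ↪-⋃ : {K : Set} {P Q : K → Subset E} → (∀ a → P a ↪ Q a) →
        (∀ a b → a ≢ b → ∀ x → Q a x → Q b x → ⊥) → ⋃ P ↪ ⋃ Q
  ↪-⋃ {K} {P} {Q} φ disjoint = record
    { to = λ { u (a , p) → to (φ a) u p }
    ; to-∈ = λ { u (a , p) → a , to-∈ (φ a) u p }
    ; injective = λ { u v (a , p) (b , q) → glued u v a b p q (lem {P = a ≡ b}) } }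
    where
    glued : ∀ u v a b (p : P a u) (q : P b v) → Dec (a ≡ b) → to (φ a) u p ≡ to (φ b) v q → u ≡ v
    glued u v a .a p q (yes refl) eq = injective (φ a) u v p q eq
    glued u v a b p q (no a≢b) eq =
      ⊥-elim (disjoint a b a≢b _ (to-∈ (φ a) u p) (subst (Q b) (sym eq) (to-∈ (φ b) v q)))

  pigeonhole : (l : List E) {P : Subset E} {e : E} → P ⊆ (_∈ l) → ¬ P e → ¬ ((P ∪ ｛ e ｝) ↪ P)
  pigeonhole [] P⊆[] e∉P φ with P⊆[] _ (to-∈ φ _ (inj₂ refl))
  ... | ()
  pigeonhole (c ∷ t) {P} {e} P⊆c∷t e∉P φ with lem {P = P c}
  ... | no c∉P = pigeonhole t (cover-tail P⊆c∷t λ u Pu u≡c → c∉P (subst P u≡c Pu)) e∉P φ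
  ... | yes Pc = pigeonhole t (cover-tail (λ u p → P⊆c∷t u (proj₁ p)) λ u p → proj₂ p)
                   (λ Pe → e∉P (proj₁ Pe)) (↪-mono shrink (λ _ p → p) (↪-delete φ (inj₁ Pc)))
    where
    shrink : ((P ∖ ｛ c ｝) ∪ ｛ e ｝) ⊆ ((P ∪ ｛ e ｝) ∖ ｛ c ｝)
    shrink u (inj₁ (Pu , u≢c)) = inj₁ Pu , u≢c
    shrink u (inj₂ refl) = inj₂ refl , λ e≡c → e∉P (subst P (sym e≡c) Pc)

-- C is a circuit through x and through a different element y; with C − x ⊆ A
-- it licenses exchanging y for x in A.
ExchangeCircuit : {E : Set} → Matroid E → Subset E → E → E → Set₁
ExchangeCircuit M C x y = Circuit M C × C x × C y × y ≢ x

module Spanning {E : Set} (M : Matroid E) where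

  spans-mono : ∀ {A B} → A ⊆ B → ∀ z → Spans M A z → Spans M B z
  spans-mono A⊆B z (inj₁ Az) = inj₁ (A⊆B z Az)
  spans-mono A⊆B z (inj₂ (C , circ , Cz , C-z⊆A)) = inj₂ (C , circ , Cz , ⊆-trans C-z⊆A A⊆B)

  same-span-trans : ∀ {A B C} → SameSpan M A B → SameSpan M B C → SameSpan M A C
  same-span-trans (A→B , B→A) (B→C , C→B) = (λ x s → B→C x (A→B x s)) , (λ x s → B→A x (C→B x s))

  same-span-≐ : ∀ {A B} → A ≐ B → SameSpan M A B
  same-span-≐ (A⊆B , B⊆A) = spans-mono A⊆B , spans-mono B⊆A

module MatroidFacts (lem : LEM) {E : Set} (M : Matroid E) where
  open Classical lem
  open Injections lem
  open Spanning M

  Ind : Subset E → Set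
  Ind = Indep M

  Base : Subset E → Set₁
  Base = MaximalIndep Ind

  deletion-not-base : ∀ {B u} → Ind B → B u → ¬ Base (B ∖ ｛ u ｝)
  deletion-not-base {B} {u} iB Bu (_ , maximal) = proj₂ (maximal B iB (λ _ → proj₁) u Bu) refl

  maximal-above-base : ∀ {B X K} → Base B → B ⊆ X → MaximalIn Ind X K → Base K
  maximal-above-base {B} {X} {K} baseB B⊆X (iK , K⊆X , maximal) = dne λ ¬baseK →
    let (b , Bb , b∉K , iK+b) = augment M iK ¬baseK baseB in
    b∉K (maximal (K ∪ ｛ b ｝) iK+b (λ _ → inj₁) (∪-⊆ K⊆X (｛｝-⊆ (B⊆X b Bb))) b (inj₂ refl))

  base-misses-one : ∀ {K B z u₀ u₁} → Base K → Ind B → K ⊆ (B ∪ ｛ z ｝) →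
                    B u₀ → ¬ K u₀ → B u₁ → ¬ K u₁ → u₀ ≡ u₁
  base-misses-one {K} {B} {z} {u₀} {u₁} baseK iB K⊆B+z Bu₀ u₀∉K Bu₁ u₁∉K
    with augment M (indep-⊆ M (λ _ → proj₁) iB) (deletion-not-base iB Bu₀) baseK
  ... | c , Kc , c∉B-u₀ , iB' =
    dne λ u₀≢u₁ → u₁∉K (proj₂ baseK _ iB' K⊆B' u₁ (inj₁ (Bu₁ , ≢-sym u₀≢u₁)))
    where
    avoids-u₀ : ∀ {w} → K w → w ≢ u₀
    avoids-u₀ Kw refl = u₀∉K Kw

    -- the element augmenting B − u₀ from K can only be z
    c≡z : c ≡ z
    c≡z with K⊆B+z c Kc
    ... | inj₁ Bc = ⊥-elim (c∉B-u₀ (Bc , avoids-u₀ Kc))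
    ... | inj₂ eq = eq

    K⊆B' : K ⊆ swap B u₀ c
    K⊆B' w Kw with K⊆B+z w Kw
    ... | inj₁ Bw = inj₁ (Bw , avoids-u₀ Kw)
    ... | inj₂ w≡z = inj₂ (trans w≡z (sym c≡z))

  -- The fundamental circuit of y over A: y and the elements u of A such that
  -- A − u + y is independent.
  fundamental : Subset E → E → Subset E
  fundamental A y u = u ≡ y ⊎ (A u × Ind (swap A u y))

  fundamental-⊆ : ∀ {A y} → fundamental A y ⊆ (A ∪ ｛ y ｝)
  fundamental-⊆ u (inj₁ u≡y) = inj₂ u≡y
  fundamental-⊆ u (inj₂ (Au , _)) = inj₁ Au

  -- Were it independent, extend it to K maximal in A + y, and K to K' maximal in
  -- K ∪ B for a base B ⊇ A.  Then K' is a base inside B + y, so it misses at most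
  -- one element of B; this gives A − u + y ⊆ K, hence u ∈ K, for every u ∈ A.
  -- So the dependent set A + y would lie in K.
  fundamental-dependent : ∀ {A y} → Ind A → ¬ Ind (A ∪ ｛ y ｝) → ¬ Ind (fundamental A y)
  fundamental-dependent {A} {y} iA dep iF
    with extend M (A ∪ ｛ y ｝) (fundamental A y) iF fundamental-⊆
  ... | K , F⊆K , iK , K⊆A+y , maximalK
    with extend M (λ _ → ⊤) A iA (λ _ _ → tt)
  ... | B , A⊆B , iB , _ , maximalB
    with extend M (K ∪ B) K iK (λ _ → inj₁)
  ... | K' , K⊆K' , maxK'@(iK' , K'⊆K∪B , _) = dep (indep-⊆ M A+y⊆K iK)
    where
    baseK' : Base K'
    baseK' = maximal-above-base (iB , λ J iJ B⊆J → maximalB J iJ B⊆J (λ _ _ → tt)) (λ _ → inj₂) maxK'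

    K'⊆B+y : K' ⊆ (B ∪ ｛ y ｝)
    K'⊆B+y = ⊆-trans K'⊆K∪B (∪-⊆ (⊆-trans K⊆A+y (∪-⊆ (λ x Ax → inj₁ (A⊆B x Ax)) (λ _ → inj₂))) (λ _ → inj₁))

    -- K is maximal in A + y, so elements of A outside K are outside K' too
    outside : ∀ {u} → A u → ¬ K u → ¬ K' u
    outside {u} Au u∉K K'u = u∉K (maximalK (K ∪ ｛ u ｝)
      (indep-⊆ M (∪-⊆ K⊆K' (｛｝-⊆ K'u)) iK') (λ _ → inj₁) (∪-⊆ K⊆A+y (｛｝-⊆ (inj₁ Au))) u (inj₂ refl))

    Ky : K y
    Ky = F⊆K y (inj₁ refl)

    swap⊆K : ∀ {u} → A u → ¬ K u → swap A u y ⊆ K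
    swap⊆K Au u∉K x (inj₁ (Ax , x≢u)) = dne λ x∉K →
      x≢u (sym (base-misses-one baseK' iB K'⊆B+y (A⊆B _ Au) (outside Au u∉K) (A⊆B _ Ax) (outside Ax x∉K)))
    swap⊆K _ _ x (inj₂ refl) = Ky

    A+y⊆K : (A ∪ ｛ y ｝) ⊆ K
    A+y⊆K u (inj₁ Au) = dne λ u∉K → u∉K (F⊆K u (inj₂ (Au , indep-⊆ M (swap⊆K Au u∉K) iK)))
    A+y⊆K u (inj₂ refl) = Ky

  fundamental-without : ∀ {A y x} → Ind A → fundamental A y x →
                        Σ (Subset E) λ S → Ind S × (fundamental A y ∖ ｛ x ｝) ⊆ S
  fundamental-without {A} iA (inj₁ refl) = A , iA , λ
    { u (inj₁ u≡y , u≢y) → ⊥-elim (u≢y u≡y)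
    ; u (inj₂ (Au , _) , _) → Au }
  fundamental-without {A} {y} {x} iA (inj₂ (Ax , iS)) = swap A x y , iS , λ
    { u (inj₁ u≡y , _) → inj₂ u≡y
    ; u (inj₂ (Au , _) , u≢x) → inj₁ (Au , u≢x) }

  fundamental-circuit : ∀ {A y} → Ind A → ¬ Ind (A ∪ ｛ y ｝) → Circuit M (fundamental A y)
  fundamental-circuit {A} {y} iA dep = fundamental-dependent iA dep , minimal
    where
    minimal : ∀ D → D ⊆ fundamental A y → ¬ Ind D → fundamental A y ⊆ D
    minimal D D⊆F depD x Fx with fundamental-without iA Fx
    ... | S , iS , F-x⊆S = dne λ x∉D →
      depD (indep-⊆ M (λ d Dd → F-x⊆S d (D⊆F d Dd , λ d≡x → x∉D (subst D d≡x Dd))) iS)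

  fundamental-⊆-circuit : ∀ {A y C} → Circuit M C → C ⊆ (A ∪ ｛ y ｝) → C y → fundamental A y ⊆ C
  fundamental-⊆-circuit {C = C} _ _ Cy u (inj₁ refl) = Cy
  fundamental-⊆-circuit {C = C} (depC , _) C⊆A+y _ u (inj₂ (Au , iS)) = dne λ u∉C →
    depC (indep-⊆ M (λ c Cc → [ (λ Ac → inj₁ (Ac , λ c≡u → u∉C (subst C c≡u Cc))) , inj₂ ] (C⊆A+y c Cc)) iS)

  circuit-⊆-fundamental : ∀ {A y C} → Ind A → Circuit M C → C ⊆ (A ∪ ｛ y ｝) → C y → C ⊆ fundamental A y
  circuit-⊆-fundamental {A} {y} {C} iA circ C⊆A+y Cy =
    proj₂ circ (fundamental A y) (fundamental-⊆-circuit circ C⊆A+y Cy)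
      (fundamental-dependent iA λ iA+y → proj₁ circ (indep-⊆ M C⊆A+y iA+y))

  circuit-unique : ∀ {T y C D} → Ind T → Circuit M C → Circuit M D →
                   C ⊆ (T ∪ ｛ y ｝) → D ⊆ (T ∪ ｛ y ｝) → C y → D y → C ⊆ D
  circuit-unique iT circC circD C⊆T+y D⊆T+y Cy Dy =
    ⊆-trans (circuit-⊆-fundamental iT circC C⊆T+y Cy) (fundamental-⊆-circuit circD D⊆T+y Dy)

  dependent⇒spans : ∀ {A y} → Ind A → ¬ Ind (A ∪ ｛ y ｝) → Spans M A y
  dependent⇒spans {A} {y} iA dep = inj₂ (fundamental A y , fundamental-circuit iA dep , inj₁ refl , rest)
    where
    rest : (fundamental A y ∖ ｛ y ｝) ⊆ A
    rest x (inj₁ x≡y , x≢y) = ⊥-elim (x≢y x≡y)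
    rest x (inj₂ (Ax , _) , _) = Ax

  unspanned⇒independent : ∀ {A y} → Ind A → ¬ Spans M A y → Ind (A ∪ ｛ y ｝)
  unspanned⇒independent iA ¬spans = dne λ dep → ¬spans (dependent⇒spans iA dep)

  circuit-outside : ∀ {A C x} → Ind A → Circuit M C → (C ∖ ｛ x ｝) ⊆ A → ¬ A x
  circuit-outside iA (depC , _) C-x⊆A Ax =
    depC (indep-⊆ M (⊆-trans (add-back C-x⊆A) (∪-⊆ (λ _ Au → Au) (｛｝-⊆ Ax))) iA)

  exchange-independent : ∀ {A C x y} → Ind A → ExchangeCircuit M C x y → (C ∖ ｛ x ｝) ⊆ A →
                         Ind (swap A y x)
  exchange-independent iA (circ , Cx , Cy , y≢x) C-x⊆A
    with circuit-⊆-fundamental iA circ (add-back C-x⊆A) Cx _ Cy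
  ... | inj₁ y≡x = ⊥-elim (y≢x y≡x)
  ... | inj₂ (_ , independent) = independent

  -- If A spans z ∉ A' via a circuit
  -- D, then A' + z is dependent: else C and D would both be the circuit of y over
  -- A' + z, putting x into D − z ⊆ A.
  exchange-spans : ∀ {A C x y} → Ind A → ExchangeCircuit M C x y → (C ∖ ｛ x ｝) ⊆ A →
                   ∀ z → Spans M A z → Spans M (swap A y x) z
  exchange-spans {A} {C} {x} {y} iA ex@(circ , Cx , Cy , y≢x) C-x⊆A z spansA with lem {P = swap A y x z}
  ... | yes z∈A' = inj₁ z∈A'
  ... | no z∉A' = via spansA
    where
    iA' : Ind (swap A y x)
    iA' = exchange-independent iA ex C-x⊆A

    via : Spans M A z → Spans M (swap A y x) z
    via (inj₁ Az) = inj₂ (C , circ , subst C (sym z≡y) Cy ,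
                          subst (λ w → (C ∖ ｛ w ｝) ⊆ swap A y x) (sym z≡y) (swap-support C-x⊆A))
      where
      z≡y : z ≡ y
      z≡y = dne λ z≢y → z∉A' (inj₁ (Az , z≢y))
    via (inj₂ (D , circD , Dz , D-z⊆A)) = dependent⇒spans iA' λ iT →
      circuit-outside iA circ C-x⊆A (D-z⊆A x (x∈D iT , λ x≡z → z∉A' (inj₂ (sym x≡z))))
      where
      T+y : Subset E
      T+y = (swap A y x ∪ ｛ z ｝) ∪ ｛ y ｝

      A⊆T+y : A ⊆ T+y
      A⊆T+y u Au with lem {P = u ≡ y}
      ... | yes u≡y = inj₂ u≡y
      ... | no u≢y = inj₁ (inj₁ (inj₁ (Au , u≢y)))

      C⊆T+y : C ⊆ T+y
      C⊆T+y = ⊆-trans (add-back C-x⊆A) (∪-⊆ A⊆T+y λ u u≡x → inj₁ (inj₁ (inj₂ u≡x)))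

      D⊆T+y : D ⊆ T+y
      D⊆T+y = ⊆-trans (add-back D-z⊆A) (∪-⊆ A⊆T+y λ u u≡z → inj₁ (inj₂ u≡z))

      x∈D : Ind (swap A y x ∪ ｛ z ｝) → D x
      x∈D iT = circuit-unique iT circ circD C⊆T+y D⊆T+y Cy Dy x Cx
        where
        Dy : D y
        Dy = dne λ y∉D → proj₁ circD (indep-⊆ M (drop-point y∉D D⊆T+y) iT)

  exchange : ∀ {A C x y} → Ind A → ExchangeCircuit M C x y → (C ∖ ｛ x ｝) ⊆ A →
             Ind (swap A y x) × SameSpan M (swap A y x) A
  exchange {A} {C} {x} {y} iA ex@(circ , Cx , Cy , y≢x) C-x⊆A =
    iA' , undo , exchange-spans iA ex C-x⊆A
    where
    iA' : Ind (swap A y x)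
    iA' = exchange-independent iA ex C-x⊆A

    swap-back : swap (swap A y x) x y ⊆ A
    swap-back u (inj₁ (inj₁ (Au , _) , _)) = Au
    swap-back u (inj₁ (inj₂ u≡x , u≢x)) = ⊥-elim (u≢x u≡x)
    swap-back u (inj₂ refl) = C-x⊆A y (Cy , y≢x)

    undo : ∀ z → Spans M (swap A y x) z → Spans M A z
    undo z s = spans-mono swap-back z
      (exchange-spans iA' (circ , Cy , Cx , ≢-sym y≢x) (swap-support C-x⊆A) z s)

  -- By induction on a list covering
  -- A ∖ B: its head h is dispensable (A − h still spans B), or some b ∈ B needs h,
  -- and then exchanging h for b moves b into A.
  finite-exchange : ∀ {B} → Ind B → (l : List E) → ∀ {A} → Ind A →
                    (∀ u → B u → Spans M A u) → (A ∖ B) ⊆ (_∈ l) → (B ∖ A) ↪ (A ∖ B)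
  finite-exchange {B} iB [] {A} iA spanned A∖B⊆[] = ↪-empty outside
    where
    A⊆B : A ⊆ B
    A⊆B u Au = dne λ u∉B → ¬Any[] (A∖B⊆[] u (Au , u∉B))

    outside : ∀ u → ¬ (B ∖ A) u
    outside u (Bu , u∉A) with spanned u Bu
    ... | inj₁ Au = u∉A Au
    ... | inj₂ (C , (depC , _) , Cu , C-u⊆A) =
      depC (indep-⊆ M (⊆-trans (add-back C-u⊆A) (∪-⊆ A⊆B (｛｝-⊆ Bu))) iB)
  finite-exchange {B} iB (h ∷ t) {A} iA spanned covered with lem {P = (A ∖ B) h}
  ... | no h∉A∖B = finite-exchange iB t iA spanned
                     (cover-tail covered λ u p u≡h → h∉A∖B (subst (A ∖ B) u≡h p))
  ... | yes (Ah , h∉B) with lem {P = Σ E λ b → B b × ¬ Spans M (A ∖ ｛ h ｝) b}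
  ...   | no none-needs-h =
    ↪-mono (λ u (Bu , u∉A) → Bu , λ A-h-u → u∉A (proj₁ A-h-u)) (λ u ((Au , _) , u∉B) → Au , u∉B)
      (finite-exchange iB t (indep-⊆ M (λ _ → proj₁) iA)
        (λ u Bu → dne λ ¬spans → none-needs-h (u , Bu , ¬spans))
        (cover-tail (λ u ((Au , _) , u∉B) → covered u (Au , u∉B)) λ u ((_ , u≢h) , _) → u≢h))
  ...   | yes (b , Bb , b-needs-h) with spanned b Bb
  ...     | inj₁ Ab = ⊥-elim (b-needs-h (inj₁ (Ab , λ b≡h → h∉B (subst B b≡h Bb))))
  ...     | inj₂ (C , circ , Cb , C-b⊆A) =
    ↪-mono B∖A⊆ (∪-⊆ (λ u p → proj₁ (A''∖B⊆ u p)) (｛｝-⊆ (Ah , h∉B)))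
      (↪-insert (finite-exchange iB t (proj₁ exchanged) spanned''
                   (cover-tail (λ u p → covered u (proj₁ (A''∖B⊆ u p))) λ u p → proj₂ (A''∖B⊆ u p)))
                h∉A''∖B)
    where
    h≢b : h ≢ b
    h≢b h≡b = h∉B (subst B (sym h≡b) Bb)

    -- the circuit of b over A passes through h, since b is not spanned by A − h
    Ch : C h
    Ch = dne λ h∉C → b-needs-h (inj₂ (C , circ , Cb , λ c (Cc , c≢b) →
           C-b⊆A c (Cc , c≢b) , λ c≡h → h∉C (subst C c≡h Cc)))

    exchanged : Ind (swap A h b) × SameSpan M (swap A h b) A
    exchanged = exchange iA (circ , Cb , Ch , h≢b) C-b⊆A

    spanned'' : ∀ u → B u → Spans M (swap A h b) u
    spanned'' u Bu = proj₂ (proj₂ exchanged) u (spanned u Bu)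

    A''∖B⊆ : (swap A h b ∖ B) ⊆ ((A ∖ B) ∖ ｛ h ｝)
    A''∖B⊆ u (inj₁ (Au , u≢h) , u∉B) = (Au , u∉B) , u≢h
    A''∖B⊆ u (inj₂ u≡b , u∉B) = ⊥-elim (u∉B (subst B (sym u≡b) Bb))

    h∉A''∖B : ¬ (swap A h b ∖ B) h
    h∉A''∖B (inj₁ (_ , h≢h) , _) = h≢h refl
    h∉A''∖B (inj₂ h≡b , _) = h≢b h≡b

    B∖A⊆ : (B ∖ A) ⊆ ((B ∖ swap A h b) ∪ ｛ b ｝)
    B∖A⊆ u (Bu , u∉A) with lem {P = u ≡ b}
    ... | yes u≡b = inj₂ u≡b
    ... | no u≢b = inj₁ (Bu , λ { (inj₁ (Au , _)) → u∉A Au ; (inj₂ u≡b) → u≢b u≡b })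

  -- At each step j < n with
  -- P j, the element xs (suc j) is exchanged for xs j along Cs j.  If no circuit
  -- Cs j contains an element xs (suc l) removed at a later step l (triangularity),
  -- the exchanges can be performed one at a time, last step first, and the result
  -- is independent with the same span as the starting set.
  module MultiExchange (xs : ℕ → E) (Cs : ℕ → Subset E) (P : ℕ → Set) (n : ℕ)
    (valid : ∀ j → j < n → P j → ExchangeCircuit M (Cs j) (xs j) (xs (suc j)))
    (triangular : ∀ j l → j < l → l < n → P j → P l → ¬ Cs j (xs (suc l))) where

    Below : ℕ → (ℕ → Set) → Set
    Below m Q = Σ ℕ λ j → j < m × Q j

    below-suc : ∀ {m Q} → Below (suc m) Q → Below m Q ⊎ Q m
    below-suc (j , j<1+m , Qj) with m<1+n⇒m<n∨m≡n j<1+m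
    ... | inj₁ j<m = inj₁ (j , j<m , Qj)
    ... | inj₂ refl = inj₂ Qj

    below-weaken : ∀ {m Q} → Below m Q → Below (suc m) Q
    below-weaken (j , j<m , Qj) = j , m<n⇒m<1+n j<m , Qj

    below-last : ∀ {m} {Q : ℕ → Set} → Q m → Below (suc m) Q
    below-last {m} Qm = m , n<1+n m , Qm

    Leaving : ℕ → Subset E
    Leaving m u = Below m λ j → P j × xs (suc j) ≡ u

    Entering : ℕ → Subset E
    Entering m u = Below m λ j → P j × xs j ≡ u

    after : ℕ → Subset E → Subset E
    after m A = (A ∖ Leaving m) ∪ Entering m

    Supported : ℕ → Subset E → Set
    Supported m A = ∀ j → j < m → P j → (Cs j ∖ ｛ xs j ｝) ⊆ A

    after-zero : ∀ A → after 0 A ≐ A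
    after-zero A = ∪-⊆ (λ _ → proj₁) (λ { _ (_ , () , _) }) , λ u Au → inj₁ (Au , λ { (_ , () , _) })

    after-skip : ∀ m A → ¬ P m → after m A ≐ after (suc m) A
    after-skip m A ¬Pm = forward , backward
      where
      earlier : ∀ {Q : ℕ → Set} → (∀ {j} → Q j → P j) → Below (suc m) Q → Below m Q
      earlier Q⇒P q = [ (λ q' → q') , (λ Qm → ⊥-elim (¬Pm (Q⇒P Qm))) ] (below-suc q)

      forward : after m A ⊆ after (suc m) A
      forward u (inj₁ (Au , u∉L)) = inj₁ (Au , λ l → u∉L (earlier proj₁ l))
      forward u (inj₂ en) = inj₂ (below-weaken en)

      backward : after (suc m) A ⊆ after m A
      backward u (inj₁ (Au , u∉L)) = inj₁ (Au , λ l → u∉L (below-weaken l))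
      backward u (inj₂ en) = inj₂ (earlier proj₁ en)

    after-swap : ∀ m A → P m → ¬ A (xs m) → (∀ l → l < m → P l → A (xs (suc l))) →
                 after m (swap A (xs (suc m)) (xs m)) ≐ after (suc m) A
    after-swap m A Pm xm∉A earlier-in-A = forward , backward
      where
      forward : after m (swap A (xs (suc m)) (xs m)) ⊆ after (suc m) A
      forward u (inj₁ (inj₁ (Au , u≢y) , u∉L)) =
        inj₁ (Au , λ l → [ u∉L , (λ last → u≢y (sym (proj₂ last))) ] (below-suc l))
      forward u (inj₁ (inj₂ u≡x , _)) = inj₂ (below-last (Pm , sym u≡x))
      forward u (inj₂ en) = inj₂ (below-weaken en)

      backward : after (suc m) A ⊆ after m (swap A (xs (suc m)) (xs m))
      backward u (inj₁ (Au , u∉L)) =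
        inj₁ (inj₁ (Au , λ u≡y → u∉L (below-last (Pm , sym u≡y))) , λ l → u∉L (below-weaken l))
      backward u (inj₂ en) with below-suc en
      ... | inj₁ en' = inj₂ en'
      ... | inj₂ (_ , x≡u) = inj₁ (inj₂ (sym x≡u) , λ (l , l<m , Pl , eq) →
              xm∉A (subst A (trans eq (sym x≡u)) (earlier-in-A l l<m Pl)))

    -- induction on m: perform step m first (if it is in M), then steps below m
    multi-exchange : ∀ m → m ≤ n → ∀ A → Ind A → Supported m A →
                     Ind (after m A) × SameSpan M (after m A) A
    multi-exchange zero _ A iA _ = indep-⊆ M (proj₁ (after-zero A)) iA , same-span-≐ (after-zero A)
    multi-exchange (suc m) m<n A iA supported with lem {P = P m}
    ... | no ¬Pm =
      let (iR , R~A) = multi-exchange m (<⇒≤ m<n) A iA (λ j j<m → supported j (m<n⇒m<1+n j<m))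
          R≐R' = after-skip m A ¬Pm
      in indep-⊆ M (proj₂ R≐R') iR , same-span-trans (same-span-≐ (proj₂ R≐R' , proj₁ R≐R')) R~A
    ... | yes Pm =
      let (iA' , A'~A) = exchange iA (valid m m<n Pm) (supported m (n<1+n m) Pm)
          (iR , R~A') = multi-exchange m (<⇒≤ m<n) A' iA' supported'
          R≐R' = after-swap m A Pm xm∉A earlier-in-A
      in indep-⊆ M (proj₂ R≐R') iR ,
         same-span-trans (same-span-≐ (proj₂ R≐R' , proj₁ R≐R')) (same-span-trans R~A' A'~A)
      where
      A' : Subset E
      A' = swap A (xs (suc m)) (xs m)

      -- triangularity keeps the earlier circuits away from the removed element
      supported' : Supported m A'
      supported' j j<m Pj c (Cc , c≢xj) =
        inj₁ (supported j (m<n⇒m<1+n j<m) Pj c (Cc , c≢xj) ,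
              λ c≡y → triangular j m j<m m<n Pj Pm (subst (Cs j) c≡y Cc))

      xm∉A : ¬ A (xs m)
      xm∉A = circuit-outside iA (proj₁ (valid m m<n Pm)) (supported m (n<1+n m) Pm)

      earlier-in-A : ∀ l → l < m → P l → A (xs (suc l))
      earlier-in-A l l<m Pl =
        let (_ , _ , C-leaving , leaving≢entering) = valid l (<-trans l<m m<n) Pl
        in supported l (m<n⇒m<1+n l<m) Pl _ (C-leaving , leaving≢entering)

override : ∀ {ℓ} {A : Set ℓ} → (ℕ → A) → ℕ → A → ℕ → A
override f zero a zero = a
override f zero a (suc l) = f (suc l)
override f (suc n) a zero = f zero
override f (suc n) a (suc l) = override (λ k → f (suc k)) n a l

override-at : ∀ {ℓ} {A : Set ℓ} (f : ℕ → A) n a → override f n a n ≡ a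
override-at f zero a = refl
override-at f (suc n) a = override-at (λ k → f (suc k)) n a

override-elsewhere : ∀ {ℓ} {A : Set ℓ} (f : ℕ → A) n a l → l ≢ n → override f n a l ≡ f l
override-elsewhere f zero a zero l≢n = ⊥-elim (l≢n refl)
override-elsewhere f zero a (suc l) l≢n = refl
override-elsewhere f (suc n) a zero l≢n = refl
override-elsewhere f (suc n) a (suc l) l≢n =
  override-elsewhere (λ k → f (suc k)) n a l (λ l≡n → l≢n (cong suc l≡n))

module AugmentingPaths (lem : LEM) {E K : Set} (M : K → Matroid E) (I : K → Subset E)
  (indI : ∀ i → Indep (M i) (I i)) (disjI : ∀ i j → i ≢ j → ∀ x → I i x → I j x → ⊥)
  (e : E) (e∉I : ¬ ⋃ I e) where
  open Classical lem

  Step : K → Subset E → E → E → Set₁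
  Step i C z w = ExchangeCircuit (M i) C z w × (C ∖ ｛ z ｝) ⊆ I i

  -- A path of n steps starting at e (entries beyond n are irrelevant).
  record Path (n : ℕ) : Set₁ where
    field
      vertex : ℕ → E
      matroid : ℕ → K
      circuit : ℕ → Subset E
      starts : vertex 0 ≡ e
      steps : ∀ j → j < n → Step (matroid j) (circuit j) (vertex j) (vertex (suc j))

  Reach : ℕ → E → Set₁
  Reach n w = Σ (Path n) λ p → Path.vertex p n ≡ w

  reach-start : K → Reach 0 e
  reach-start i = record
    { vertex = λ _ → e ; matroid = λ _ → i ; circuit = λ _ → ∅ ; starts = refl ; steps = λ _ () } , refl

  reach-step : ∀ {n z i C w} → Reach n z → Step i C z w → Reach (suc n) w
  reach-step {n} {z} {i} {C} {w} (p , ends) step = extended , override-at vertex (suc n) w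
    where
    open Path p

    vertex' : ℕ → E
    vertex' = override vertex (suc n) w

    steps' : ∀ j → j < suc n →
             Step (override matroid n i j) (override circuit n C j) (vertex' j) (vertex' (suc j))
    steps' j j<1+n with m<1+n⇒m<n∨m≡n j<1+n
    ... | inj₁ j<n
      rewrite override-elsewhere matroid n i j (<⇒≢ j<n)
            | override-elsewhere circuit n C j (<⇒≢ j<n)
            | override-elsewhere vertex (suc n) w j (<⇒≢ (m<n⇒m<1+n j<n))
            | override-elsewhere vertex (suc n) w (suc j) (λ 1+j≡1+n → <⇒≢ j<n (cong pred 1+j≡1+n))
      = steps j j<n
    ... | inj₂ refl
      rewrite override-at matroid j i | override-at circuit j C | override-at vertex (suc j) w
            | override-elsewhere vertex (suc j) w j (<⇒≢ (n<1+n j)) | ends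
      = step

    extended : Path (suc n)
    extended = record
      { vertex = vertex' ; matroid = override matroid n i ; circuit = override circuit n C
      ; starts = starts ; steps = steps' }

  reach-prefix : ∀ {n} (p : Path n) j → j ≤ n → Reach j (Path.vertex p j)
  reach-prefix p j j≤n = record
    { vertex = vertex ; matroid = matroid ; circuit = circuit ; starts = starts
    ; steps = λ l l<j → steps l (<-≤-trans l<j j≤n) } , refl
    where open Path p

  -- Along a shortest path to its endpoint every prefix is a shortest path; hence
  -- the vertices are distinct and no circuit contains a vertex two or more steps
  -- ahead of its own.
  module Shortest {n} (p : Path n) (shortest : ∀ m → m < n → ¬ Reach m (Path.vertex p n)) where
    open Path p

    -- a shortcut to vertex j extends along the path to a shortcut to vertex n
    shortcut : ∀ d j → j + d ≡ n → ∀ m → m < j → ¬ Reach m (vertex j)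
    shortcut zero j j+0≡n m m<j r =
      shortest m (subst (m <_) j≡n m<j) (subst (λ v → Reach m (vertex v)) j≡n r)
      where
      j≡n : j ≡ n
      j≡n = trans (sym (+-identityʳ j)) j+0≡n
    shortcut (suc d) j j+1+d≡n m m<j r =
      shortcut d (suc j) (trans (sym (+-suc j d)) j+1+d≡n) (suc m) (s≤s m<j) (reach-step r (steps j j<n))
      where
      j<n : j < n
      j<n = subst (j <_) j+1+d≡n (m<m+n j (s≤s z≤n))

    prefix-shortest : ∀ j → j ≤ n → ∀ m → m < j → ¬ Reach m (vertex j)
    prefix-shortest j j≤n = shortcut (n ∸ j) j (m+[n∸m]≡n j≤n)

    -- vertices are pairwise distinct, else a later one would be reached early
    vertex-injective : ∀ {j l} → j ≤ n → l ≤ n → vertex j ≡ vertex l → j ≡ l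
    vertex-injective {j} {l} j≤n l≤n vj≡vl with <-cmp j l
    ... | tri≈ _ j≡l _ = j≡l
    ... | tri< j<l _ _ =
      ⊥-elim (prefix-shortest l l≤n j j<l (subst (Reach j) vj≡vl (reach-prefix p j j≤n)))
    ... | tri> _ _ l<j =
      ⊥-elim (prefix-shortest j j≤n l l<j (subst (Reach l) (sym vj≡vl) (reach-prefix p l l≤n)))

    -- if circuit j contained vertex (suc l), one could jump there from vertex j
    triangular : ∀ j l → j < l → l < n → ¬ circuit j (vertex (suc l))
    triangular j l j<l l<n C∋ with steps j (<-trans j<l l<n)
    ... | (circ , Cz , _ , _) , support = prefix-shortest (suc l) l<n (suc j) (s≤s j<l)
      (reach-step (reach-prefix p j j≤n) ((circ , Cz , C∋ , jump≢start) , support))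
      where
      j≤n : j ≤ n
      j≤n = ≤-trans (<⇒≤ j<l) (<⇒≤ l<n)

      jump≢start : vertex (suc l) ≢ vertex j
      jump≢start eq = <⇒≢ (m<n⇒m<1+n j<l) (sym (vertex-injective l<n j≤n eq))

    module Augment (k : K) (free : ¬ Spans (M k) (I k) (vertex n)) where

      valid : ∀ i j → j < n → matroid j ≡ i → ExchangeCircuit (M i) (circuit j) (vertex j) (vertex (suc j))
      valid .(matroid j) j j<n refl = proj₁ (steps j j<n)

      supported : ∀ i j → j < n → matroid j ≡ i → (circuit j ∖ ｛ vertex j ｝) ⊆ I i
      supported .(matroid j) j j<n refl = proj₂ (steps j j<n)

      module Exchanges (i : K) = MatroidFacts.MultiExchange lem (M i) vertex circuit (λ j → matroid j ≡ i) n
                                   (valid i) (λ j l j<l l<n _ _ → triangular j l j<l l<n)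
      open Exchanges using (Leaving; after)

      R : K → Subset E
      R i = after i n (I i)

      exchanged : ∀ i → Indep (M i) (R i) × SameSpan (M i) (R i) (I i)
      exchanged i = Exchanges.multi-exchange i n ≤-refl (I i) (indI i) (supported i)

      J : K → Subset E
      J i u = R i u ⊎ (i ≡ k × u ≡ vertex n)

      J⊆R : ∀ {i} → i ≢ k → J i ⊆ R i
      J⊆R i≢k u (inj₁ r) = r
      J⊆R i≢k u (inj₂ (i≡k , _)) = ⊥-elim (i≢k i≡k)

      -- the endpoint is new: it is not in I_k, and entering elements precede it
      end∉R : ¬ R k (vertex n)
      end∉R (inj₁ (I-end , _)) = free (inj₁ I-end)
      end∉R (inj₂ (j , j<n , _ , vj≡end)) = <⇒≢ j<n (vertex-injective (<⇒≤ j<n) ≤-refl vj≡end)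

      -- R_k does not span the endpoint, so adding it keeps independence
      J-independent : ∀ i → Indep (M i) (J i)
      J-independent i with lem {P = i ≡ k}
      ... | yes refl = indep-⊆ (M k) (λ { u (inj₁ r) → inj₁ r ; u (inj₂ (_ , u≡end)) → inj₂ u≡end })
                         (MatroidFacts.unspanned⇒independent lem (M k) (proj₁ (exchanged k))
                           λ s → free (proj₁ (proj₂ (exchanged k)) _ s))
      ... | no i≢k = indep-⊆ (M i) (J⊆R i≢k) (proj₁ (exchanged i))

      AddedAt : K → ℕ → Set
      AddedAt a j = (j < n × matroid j ≡ a) ⊎ (j ≡ n × a ≡ k)

      classify : ∀ {a u} → J a u → (I a u × ¬ Leaving a n u) ⊎ Σ ℕ λ j → j ≤ n × vertex j ≡ u × AddedAt a j
      classify (inj₁ (inj₁ kept)) = inj₁ kept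
      classify (inj₁ (inj₂ (j , j<n , mj≡a , vj≡u))) = inj₂ (j , <⇒≤ j<n , vj≡u , inj₁ (j<n , mj≡a))
      classify (inj₂ (a≡k , u≡end)) = inj₂ (n , ≤-refl , sym u≡end , inj₂ (refl , a≡k))

      vertex-origin : ∀ j → j ≤ n → ∀ {u} → vertex j ≡ u → u ≡ e ⊎ Σ K λ c → I c u × Leaving c n u
      vertex-origin zero _ v0≡u = inj₁ (trans (sym v0≡u) starts)
      vertex-origin (suc j) j<n refl with steps j j<n
      ... | (_ , _ , C∋ , jump≢start) , support =
        inj₂ (matroid j , support _ (C∋ , jump≢start) , (j , j<n , refl , refl))

      -- an added vertex is not kept: it is e, or left its own set I_c, and the I's are disjoint
      added-not-kept : ∀ {a b u j} → I a u → ¬ Leaving a n u → j ≤ n → vertex j ≡ u → AddedAt b j → ⊥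
      added-not-kept {a} {u = u} Iau kept j≤n vj≡u _ with vertex-origin _ j≤n vj≡u
      ... | inj₁ u≡e = e∉I (a , subst (I a) u≡e Iau)
      ... | inj₂ (c , Icu , leaves) with lem {P = a ≡ c}
      ...   | yes refl = kept leaves
      ...   | no a≢c = disjI a c a≢c u Iau Icu

      -- a vertex is added to only one set, as vertices are distinct
      added-once : ∀ {a b j l} → a ≢ b → j ≤ n → l ≤ n → vertex j ≡ vertex l → AddedAt a j → AddedAt b l → ⊥
      added-once a≢b j≤n l≤n vj≡vl added-a added-b with vertex-injective j≤n l≤n vj≡vl
      added-once a≢b _ _ _ (inj₁ (_ , mj≡a)) (inj₁ (_ , mj≡b)) | refl = a≢b (trans (sym mj≡a) mj≡b)
      added-once _ _ _ _ (inj₁ (j<n , _)) (inj₂ (j≡n , _)) | refl = <⇒≢ j<n j≡n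
      added-once _ _ _ _ (inj₂ (j≡n , _)) (inj₁ (j<n , _)) | refl = <⇒≢ j<n j≡n
      added-once a≢b _ _ _ (inj₂ (_ , a≡k)) (inj₂ (_ , b≡k)) | refl = a≢b (trans a≡k (sym b≡k))

      J-disjoint : ∀ a b → a ≢ b → ∀ u → J a u → J b u → ⊥
      J-disjoint a b a≢b u Jau Jbu with classify Jau | classify Jbu
      ... | inj₁ (Iau , _) | inj₁ (Ibu , _) = disjI a b a≢b u Iau Ibu
      ... | inj₁ (Iau , kept) | inj₂ (j , j≤n , vj≡u , added) = added-not-kept Iau kept j≤n vj≡u added
      ... | inj₂ (j , j≤n , vj≡u , added) | inj₁ (Ibu , kept) = added-not-kept Ibu kept j≤n vj≡u added
      ... | inj₂ (j , j≤n , vj≡u , added-a) | inj₂ (l , l≤n , vl≡u , added-b) =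
        added-once a≢b j≤n l≤n (trans vj≡u (sym vl≡u)) added-a added-b

      vertex-in-J : ∀ j → j ≤ n → ⋃ J (vertex j)
      vertex-in-J j j≤n with m≤n⇒m<n∨m≡n j≤n
      ... | inj₁ j<n = matroid j , inj₁ (inj₂ (j , j<n , refl , refl))
      ... | inj₂ refl = k , inj₂ (refl , refl)

      -- (c) the union is ⋃ I + e: kept elements stay, removed ones are vertices
      J-union : ⋃ J ≐ (⋃ I ∪ ｛ e ｝)
      J-union = J⊆ , ⊆J
        where
        J⊆ : ⋃ J ⊆ (⋃ I ∪ ｛ e ｝)
        J⊆ u (a , Jau) with classify Jau
        ... | inj₁ (Iau , _) = inj₁ (a , Iau)
        ... | inj₂ (j , j≤n , vj≡u , _) with vertex-origin j j≤n vj≡u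
        ...   | inj₁ u≡e = inj₂ u≡e
        ...   | inj₂ (c , Icu , _) = inj₁ (c , Icu)

        ⊆J : (⋃ I ∪ ｛ e ｝) ⊆ ⋃ J
        ⊆J u (inj₂ refl) = subst (⋃ J) starts (vertex-in-J 0 z≤n)
        ⊆J u (inj₁ (i , Iiu)) with lem {P = Leaving i n u}
        ... | no kept = i , inj₁ (inj₁ (Iiu , kept))
        ... | yes (j , j<n , _ , vj≡u) = subst (⋃ J) vj≡u (vertex-in-J (suc j) j<n)

      step-list : ℕ → List (Σ K λ _ → E)
      step-list zero = []
      step-list (suc m) = (matroid m , vertex m) ∷ (matroid m , vertex (suc m)) ∷ step-list m

      in-step-list : ∀ {m j} → j < m →
                     (matroid j , vertex j) ∈ step-list m × (matroid j , vertex (suc j)) ∈ step-list m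
      in-step-list {suc m} j<1+m with m<1+n⇒m<n∨m≡n j<1+m
      ... | inj₁ j<m = there (there (proj₁ (in-step-list j<m))) , there (there (proj₂ (in-step-list j<m)))
      ... | inj₂ refl = here refl , there (here refl)

      -- (d) I and J differ only at the ends of steps and at the endpoint
      J-finite : FiniteTotalSymDiff I J
      J-finite = (k , vertex n) ∷ step-list n , changed
        where
        changed : ∀ i x → (I i △ J i) x → (i , x) ∈ (k , vertex n) ∷ step-list n
        changed i x (inj₁ (Iix , x∉J)) with lem {P = Leaving i n x}
        ... | no kept = ⊥-elim (x∉J (inj₁ (inj₁ (Iix , kept))))
        ... | yes (j , j<n , mj≡i , vj≡x) =
          there (subst (_∈ step-list n) (cong₂ _,_ mj≡i vj≡x) (proj₂ (in-step-list j<n)))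
        changed i x (inj₂ (Jix , x∉I)) with classify Jix
        ... | inj₁ (Iix , _) = ⊥-elim (x∉I Iix)
        ... | inj₂ (j , _ , vj≡x , inj₁ (j<n , mj≡i)) =
          there (subst (_∈ step-list n) (cong₂ _,_ mj≡i vj≡x) (proj₁ (in-step-list j<n)))
        ... | inj₂ (j , _ , vj≡x , inj₂ (refl , i≡k)) = here (cong₂ _,_ i≡k (sym vj≡x))

      J-span : ∀ i → i ≢ k → SameSpan (M i) (J i) (I i)
      J-span i i≢k = Spanning.same-span-trans (M i)
        (Spanning.same-span-≐ (M i) (J⊆R i≢k , λ _ → inj₁)) (proj₂ (exchanged i))

      Jk-span : SameSpan (M k) (J k ∖ ｛ vertex n ｝) (I k)
      Jk-span = Spanning.same-span-trans (M k)
        (Spanning.same-span-≐ (M k) (Jk-end⊆R , R⊆Jk-end)) (proj₂ (exchanged k))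
        where
        Jk-end⊆R : (J k ∖ ｛ vertex n ｝) ⊆ R k
        Jk-end⊆R u (inj₁ r , _) = r
        Jk-end⊆R u (inj₂ (_ , u≡end) , u≢end) = ⊥-elim (u≢end u≡end)

        R⊆Jk-end : R k ⊆ (J k ∖ ｛ vertex n ｝)
        R⊆Jk-end u r = inj₁ r , λ u≡end → end∉R (subst (R k) u≡end r)

      outcome1 : Outcome1 M I e
      outcome1 = J , k , J-independent , J-disjoint , J-union , J-finite , J-span ,
                 (vertex n , inj₂ (refl , refl) , Jk-span)

  FreeEnd : Set₁
  FreeEnd = Σ ℕ λ n → Σ E λ w → Reach n w × Σ K λ k → ¬ Spans (M k) (I k) w

  outcome1 : FreeEnd → Outcome1 M I e
  outcome1 (n₀ , w , r₀ , k , free) with least (λ m → Reach m w) n₀ r₀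
  ... | n , (p , ends) , minimal = Shortest.Augment.outcome1 p
          (λ m m<n r → minimal m m<n (subst (Reach m) ends r)) k
          (subst (λ v → ¬ Spans (M k) (I k) v) (sym ends) free)

  -- Otherwise the reachable elements of ⋃ I form the set X of outcome (2): the
  -- circuit through a reachable y lies in X, as its elements are reachable from y.
  -- (Reachability quantifies over circuits; excluded middle makes it a small set.)
  outcome2 : ¬ FreeEnd → Outcome2 M I e
  outcome2 none = X , (λ u Xu → proj₁ (toWitness Xu)) , spans
    where
    X : Subset E
    X u = True (lem {P = ⋃ I u × Σ ℕ λ m → Reach m u})

    spans-reachable : ∀ i y → Σ ℕ (λ m → Reach m y) → Spans (M i) (I i ∩ X) y
    spans-reachable i y (m , r) with lem {P = Spans (M i) (I i) y}
    ... | no unspanned = ⊥-elim (none (m , y , r , i , unspanned))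
    ... | yes (inj₁ Iiy) = inj₁ (Iiy , fromWitness ((i , Iiy) , m , r))
    ... | yes (inj₂ (C , circ , Cy , C-y⊆I)) = inj₂ (C , circ , Cy , λ u C-y∋u →
            C-y⊆I u C-y∋u , fromWitness ((i , C-y⊆I u C-y∋u) ,
              suc m , reach-step r ((circ , Cy , proj₁ C-y∋u , proj₂ C-y∋u) , C-y⊆I)))

    spans : ∀ i → SpansSet (M i) (I i ∩ X) (X ∪ ｛ e ｝)
    spans i y (inj₁ Xy) = spans-reachable i y (proj₂ (toWitness Xy))
    spans i y (inj₂ refl) = spans-reachable i e (0 , reach-start i)

  dichotomy : Outcome1 M I e ⊎ Outcome2 M I e
  dichotomy with lem {P = FreeEnd}
  ... | yes free = inj₁ (outcome1 free)
  ... | no none = inj₂ (outcome2 none)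

module Exclusivity (lem : LEM) {E K : Set} (M : K → Matroid E) (I : K → Subset E)
  (indI : ∀ i → Indep (M i) (I i)) (disjI : ∀ i j → i ≢ j → ∀ x → I i x → I j x → ⊥)
  (e : E) (e∉I : ¬ ⋃ I e) where
  open Injections lem

  -- In each M_a the set J_a ∩ (X + e) is independent and spanned by I_a ∩ X, which
  -- differs from it in finitely many elements, so finite exchange injects what
  -- J_a adds to X + e into what it removes from X.  Gluing over a injects the
  -- finite set of removed elements, together with e, into itself.
  exclusive : Outcome1 M I e → Outcome2 M I e → ⊥
  exclusive (J , _ , J-independent , _ , (_ , ⊆J) , (L , finite) , _) (X , X⊆I , spans) =
    pigeonhole (map proj₂ L) removed-finite (λ (a , (Iae , _) , _) → e∉I (a , Iae))
      (↪-mono (∪-⊆ removed⊆added (｛｝-⊆ e-added)) (λ _ p → p) (↪-⋃ exchange-injection disjoint))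
    where
    Old New : K → Subset E
    Old a = I a ∩ X
    New a = J a ∩ (X ∪ ｛ e ｝)

    removed-finite : ⋃ (λ a → Old a ∖ New a) ⊆ (_∈ map proj₂ L)
    removed-finite u (a , (Iau , Xu) , u∉New) =
      ∈-map⁺ proj₂ (finite a u (inj₁ (Iau , λ Jau → u∉New (Jau , inj₁ Xu))))

    exchange-injection : ∀ a → (New a ∖ Old a) ↪ (Old a ∖ New a)
    exchange-injection a = MatroidFacts.finite-exchange lem (M a)
      (indep-⊆ (M a) (λ _ → proj₁) (J-independent a)) (map proj₂ L)
      (indep-⊆ (M a) (λ _ → proj₁) (indI a)) (λ u New-u → spans a u (proj₂ New-u))
      (λ u removed → removed-finite u (a , removed))

    disjoint : ∀ a b → a ≢ b → ∀ x → (Old a ∖ New a) x → (Old b ∖ New b) x → ⊥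
    disjoint a b a≢b x ((Iax , _) , _) ((Ibx , _) , _) = disjI a b a≢b x Iax Ibx

    removed⊆added : ⋃ (λ a → Old a ∖ New a) ⊆ ⋃ (λ a → New a ∖ Old a)
    removed⊆added u (b , (Ibu , Xu) , u∉New) with ⊆J u (inj₁ (X⊆I u Xu))
    ... | a , Jau = a , (Jau , inj₁ Xu) , not-old
      where
      not-old : ¬ Old a u
      not-old (Iau , _) with lem {P = a ≡ b}
      ... | yes refl = u∉New (Jau , inj₁ Xu)
      ... | no a≢b = disjI a b a≢b u Iau Ibu

    e-added : ⋃ (λ a → New a ∖ Old a) e
    e-added with ⊆J e (inj₂ refl)
    ... | a , Jae = a , (Jae , inj₂ refl) , λ (Iae , _) → e∉I (a , Iae)

lemma3p1 : (lem : ∀ {ℓ : Level} → ExcludedMiddle ℓ) →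
    {E K : Set} (M : K → Matroid E) (I : K → Subset E) →
    (∀ i → Indep (M i) (I i)) →
    (∀ i j → i ≢ j → ∀ x → I i x → I j x → ⊥) →
    (e : E) → ¬ ⋃ I e →
    (Outcome1 M I e ⊎ Outcome2 M I e) × ¬ (Outcome1 M I e × Outcome2 M I e)
lemma3p1 lem M I indI disjI e e∉I =
  AugmentingPaths.dichotomy lem M I indI disjI e e∉I ,
  λ (outcome₁ , outcome₂) → Exclusivity.exclusive lem M I indI disjI e e∉I outcome₁ outcome₂
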